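{- The game Wythoff is miserable.
   Context: Wythoff: positions are pairs $(x,y)$ of non-negative integers (two piles); a move either removes a positive number of tokens from one pile, or removes the same positive number of tokens from both piles (never making a pile negative). $\operatorname{mex}(S)$ is the least non-negative integer not in $S$; the normal Sprague–Grundy function is $\mathcal{G}(x)=\operatorname{mex}\{\mathcal{G}(y): x\to y\}$ (so $0$ on terminal positions); the misère function $\mathcal{G}^-$ satisfies $\mathcal{G}^-(x)=1$ for terminal $x$ and $\mathcal{G}^-(x)=\operatorname{mex}\{\mathcal{G}^-(y): x\to y\}$ otherwise. $V_{i,j}$ is the set of positions with $\mathcal{G}=i$, $\mathcal{G}^-=j$. A position is movable to a set $W$ if it has a move to some position of $W$. A game is miserable if every position $x$ satisfies at least one of: (a) $x\in V_{0,1}\cup V_{1,0}$; (b) $x$ is not movable to $V_{0,1}\cup V_{1,0}$; (c) $x$ is movable to $V_{0,1}$ and to $V_{1,0}$. -}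

module Defs where

open import Data.Nat using (ℕ; zero; suc; _+_; _∸_; _≤_; _≟_)
open import Data.Product using (_×_; _,_; ∃)
open import Data.Sum using (_⊎_)
open import Data.List using (List; []; _∷_; map; length; _++_)
open import Data.List.Membership.DecPropositional _≟_ using (_∈?_)
open import Relation.Nullary using (¬_; yes; no)
open import Relation.Binary.PropositionalEquality using (_≡_)

Pos : Set
Pos = ℕ × ℕ

data Move : Pos → Pos → Set where
  takeL    : ∀ {x y k} → 1 ≤ k → k ≤ x → Move (x , y) (x ∸ k , y)
  takeR    : ∀ {x y k} → 1 ≤ k → k ≤ y → Move (x , y) (x , y ∸ k)
  takeBoth : ∀ {x y k} → 1 ≤ k → k ≤ x → k ≤ y → Move (x , y) (x ∸ k , y ∸ k)

ks : ℕ → List ℕ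
ks zero    = []
ks (suc n) = suc n ∷ ks n

minℕ : ℕ → ℕ → ℕ
minℕ zero    _       = zero
minℕ (suc m) zero    = zero
minℕ (suc m) (suc n) = suc (minℕ m n)

options : ℕ → ℕ → List Pos
options x y =
     map (λ k → (x ∸ k , y)) (ks x)
  ++ map (λ k → (x , y ∸ k)) (ks y)
  ++ map (λ k → (x ∸ k , y ∸ k)) (ks (minℕ x y))

-- mex of a finite list: least natural number not in the list.
-- (the mex is at most the length of the list, so  suc (length l)  steps suffice)
mexGo : List ℕ → ℕ → ℕ → ℕ
mexGo l zero    n = n
mexGo l (suc f) n with n ∈? l
... | yes _ = mexGo l f (suc n)
... | no  _ = n

mex : List ℕ → ℕ
mex l = mexGo l (suc (length l)) 0

-- Fuelled Grundy computation; fuel  suc (x + y)  is enough since every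
-- option has strictly smaller pile sum.
uncurry' : {A : Set} → (ℕ → ℕ → A) → Pos → A
uncurry' f (a , b) = f a b

GF : ℕ → ℕ → ℕ → ℕ
GF zero    x y = 0
GF (suc f) x y = mex (map (uncurry' (GF f)) (options x y))

G : Pos → ℕ
G (x , y) = GF (suc (x + y)) x y

isTerminal : ℕ → ℕ → Set
isTerminal x y = (x ≡ 0) × (y ≡ 0)

GmF : ℕ → ℕ → ℕ → ℕ
GmF zero    x       y       = 0
GmF (suc f) zero    zero    = 1
GmF (suc f) x       y       = mex (map (uncurry' (GmF f)) (options x y))

Gm : Pos → ℕ
Gm (x , y) = GmF (suc (x + y)) x y

V : ℕ → ℕ → Pos → Set
V i j p = (G p ≡ i) × (Gm p ≡ j)

Movable : Pos → (Pos → Set) → Set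
Movable p W = ∃ λ q → Move p q × W q

V01∪V10 : Pos → Set
V01∪V10 p = V 0 1 p ⊎ V 1 0 p

Miserable : Set
Miserable = ∀ p →
     V01∪V10 p
  ⊎ (¬ Movable p V01∪V10)
  ⊎ (Movable p (V 0 1) × Movable p (V 1 0))

-- G and G⁻ agree everywhere except on six positions: (0,0), (1,2), (2,1),
-- where (G, G⁻) = (0, 1), and (0,1), (1,0), (2,2), where (G, G⁻) = (1, 0).
-- The key fact is that a position outside these six which can move to one
-- of them can move to one of each kind; the options of such a position then
-- realise both values 0 and 1 in either game, so swapping the values of the
-- exceptional options does not change the mex, and G⁻ = G follows by
-- induction.  Consequently V₀₁ ∪ V₁₀ is exactly the six exceptional
-- positions, and every position moving into it moves into both V₀₁ and V₁₀.
module Submission where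

open import Defs
open import Data.Nat using (ℕ; zero; suc; _+_; _∸_; _⊓_; _≤_; _<_; _≟_; z≤n; s≤s)
open import Data.Nat.Properties
open import Data.Product using (_×_; _,_; ∃; proj₁; proj₂; swap)
open import Data.Product.Properties using (≡-dec)
open import Data.Sum using (_⊎_; inj₁; inj₂)
open import Data.Empty using (⊥-elim)
open import Data.List using (List; map; length)
open import Data.List.Properties using (length-map; map-cong-local)
open import Data.List.Membership.Propositional using (_∈_; find; lose)
open import Data.List.Membership.Propositional.Properties
  using (∈-map⁺; ∈-map⁻; ∈-++⁻; ∈-++⁺ˡ; ∈-++⁺ʳ)
open import Data.List.Membership.DecPropositional _≟_ using (_∈?_)
open import Data.List.Relation.Binary.Subset.Propositional using (_⊆_)
open import Data.List.Relation.Unary.All using (tabulate)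
open import Data.List.Relation.Unary.Any using (here; there; any?)
open import Relation.Nullary using (¬_; Dec; yes; no)
open import Relation.Nullary.Decidable using (_⊎-dec_; map′)
open import Relation.Unary using (Decidable)
open import Relation.Binary.PropositionalEquality

_≟ₚ_ : (p q : Pos) → Dec (p ≡ q)
_≟ₚ_ = ≡-dec _≟_ _≟_

move-left : ∀ a {k y} → Move (a + suc k , y) (a , y)
move-left a {k} {y} = subst (λ z → Move (a + suc k , y) (z , y)) (m+n∸n≡m a (suc k))
  (takeL (s≤s z≤n) (m≤n+m (suc k) a))

move-right : ∀ b {k x} → Move (x , b + suc k) (x , b)
move-right b {k} {x} = subst (λ z → Move (x , b + suc k) (x , z)) (m+n∸n≡m b (suc k))
  (takeR (s≤s z≤n) (m≤n+m (suc k) b))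

move-diagonal : ∀ a b {k} → Move (a + suc k , b + suc k) (a , b)
move-diagonal a b {k} = subst₂ (λ u v → Move (a + suc k , b + suc k) (u , v))
  (m+n∸n≡m a (suc k)) (m+n∸n≡m b (suc k))
  (takeBoth (s≤s z≤n) (m≤n+m (suc k) a) (m≤n+m (suc k) b))

swap-move : ∀ {p q} → Move p q → Move (swap p) (swap q)
swap-move (takeL 1≤k k≤x)         = takeR 1≤k k≤x
swap-move (takeR 1≤k k≤y)         = takeL 1≤k k≤y
swap-move (takeBoth 1≤k k≤x k≤y) = takeBoth 1≤k k≤y k≤x

move-decreases-sum : ∀ {x y a b} → Move (x , y) (a , b) → a + b < x + y
move-decreases-sum {y = y} (takeL 1≤k k≤x) = +-monoˡ-< y (∸-monoʳ-< 1≤k k≤x)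
move-decreases-sum {x = x} (takeR 1≤k k≤y) = +-monoʳ-< x (∸-monoʳ-< 1≤k k≤y)
move-decreases-sum (takeBoth 1≤k k≤x k≤y) =
  +-mono-< (∸-monoʳ-< 1≤k k≤x) (∸-monoʳ-< 1≤k k≤y)

∈-ks⁻ : ∀ {k n} → k ∈ ks n → 1 ≤ k × k ≤ n
∈-ks⁻ {n = suc n} (here refl) = s≤s z≤n , ≤-refl
∈-ks⁻ {n = suc n} (there k∈) = proj₁ (∈-ks⁻ k∈) , m≤n⇒m≤1+n (proj₂ (∈-ks⁻ k∈))

∈-ks⁺ : ∀ {k n} → 1 ≤ k → k ≤ n → k ∈ ks n
∈-ks⁺ {n = zero}  (s≤s _) ()
∈-ks⁺ {n = suc n} 1≤k k≤1+n with m≤n⇒m<n∨m≡n k≤1+n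
... | inj₁ k<1+n = there (∈-ks⁺ 1≤k (≤-pred k<1+n))
... | inj₂ refl  = here refl

minℕ≗⊓ : ∀ m n → minℕ m n ≡ m ⊓ n
minℕ≗⊓ zero    n       = refl
minℕ≗⊓ (suc m) zero    = refl
minℕ≗⊓ (suc m) (suc n) = cong suc (minℕ≗⊓ m n)

∈-options⇒Move : ∀ {x y q} → q ∈ options x y → Move (x , y) q
∈-options⇒Move {x} {y} q∈ with ∈-++⁻ (map (λ k → (x ∸ k , y)) (ks x)) q∈
... | inj₁ q∈ˡ with ∈-map⁻ (λ k → (x ∸ k , y)) q∈ˡ
...   | k , k∈ , refl = takeL (proj₁ (∈-ks⁻ k∈)) (proj₂ (∈-ks⁻ k∈))
∈-options⇒Move {x} {y} q∈ | inj₂ q∈ʳ with ∈-++⁻ (map (λ k → (x , y ∸ k)) (ks y)) q∈ʳ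
... | inj₁ q∈ᵐ with ∈-map⁻ (λ k → (x , y ∸ k)) q∈ᵐ
...   | k , k∈ , refl = takeR (proj₁ (∈-ks⁻ k∈)) (proj₂ (∈-ks⁻ k∈))
∈-options⇒Move {x} {y} q∈ | inj₂ q∈ʳ | inj₂ q∈ᵈ with ∈-map⁻ (λ k → (x ∸ k , y ∸ k)) q∈ᵈ
... | k , k∈ , refl with ∈-ks⁻ k∈
...   | 1≤k , k≤min rewrite minℕ≗⊓ x y =
        takeBoth 1≤k (m≤n⊓o⇒m≤n x y k≤min) (m≤n⊓o⇒m≤o x y k≤min)

Move⇒∈-options : ∀ {x y q} → Move (x , y) q → q ∈ options x y
Move⇒∈-options {x} {y} (takeL 1≤k k≤x) =
  ∈-++⁺ˡ (∈-map⁺ (λ k → (x ∸ k , y)) (∈-ks⁺ 1≤k k≤x))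
Move⇒∈-options {x} {y} (takeR 1≤k k≤y) =
  ∈-++⁺ʳ (map (λ k → (x ∸ k , y)) (ks x))
    (∈-++⁺ˡ (∈-map⁺ (λ k → (x , y ∸ k)) (∈-ks⁺ 1≤k k≤y)))
Move⇒∈-options {x} {y} (takeBoth 1≤k k≤x k≤y) =
  ∈-++⁺ʳ (map (λ k → (x ∸ k , y)) (ks x))
    (∈-++⁺ʳ (map (λ k → (x , y ∸ k)) (ks y))
      (∈-map⁺ (λ k → (x ∸ k , y ∸ k))
        (∈-ks⁺ 1≤k (subst (_ ≤_) (sym (minℕ≗⊓ x y)) (⊓-glb k≤x k≤y)))))

options-decrease-sum : ∀ x y {a b} → (a , b) ∈ options x y → a + b < x + y
options-decrease-sum x y a∈ = move-decreases-sum (∈-options⇒Move {x} {y} a∈)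

movable? : ∀ {P : Pos → Set} → Decidable P → ∀ p → Dec (Movable p P)
movable? P? (x , y) = map′
  (λ some → let q , q∈ , Pq = find some in q , ∈-options⇒Move q∈ , Pq)
  (λ { (q , move , Pq) → lose (Move⇒∈-options move) Pq })
  (any? P? (options x y))

mexGo-cong : ∀ {xs ys} → xs ⊆ ys → ys ⊆ xs → ∀ f n → mexGo xs f n ≡ mexGo ys f n
mexGo-cong xs⊆ys ys⊆xs zero    n = refl
mexGo-cong {xs} {ys} xs⊆ys ys⊆xs (suc f) n with n ∈? xs | n ∈? ys
... | yes _    | yes _    = mexGo-cong xs⊆ys ys⊆xs f (suc n)
... | yes n∈xs | no  n∉ys = ⊥-elim (n∉ys (xs⊆ys n∈xs))
... | no  n∉xs | yes n∈ys = ⊥-elim (n∉xs (ys⊆xs n∈ys))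
... | no  _    | no  _    = refl

-- The fuel of mex depends on the length, hence the first hypothesis.
mex-cong : ∀ {xs ys} → length xs ≡ length ys → xs ⊆ ys → ys ⊆ xs → mex xs ≡ mex ys
mex-cong {xs} {ys} |xs|≡|ys| xs⊆ys ys⊆xs rewrite |xs|≡|ys| =
  mexGo-cong xs⊆ys ys⊆xs (suc (length ys)) 0

map-⊆-map : ∀ {A B : Set} {f g : A → B} {xs : List A} →
  (∀ {a} → a ∈ xs → ∃ λ b → b ∈ xs × f a ≡ g b) → map f xs ⊆ map g xs
map-⊆-map {g = g} {xs} match v∈ with ∈-map⁻ _ v∈
... | a , a∈ , refl with match a∈
...   | b , b∈ , fa≡gb = subst (_∈ map g xs) (sym fa≡gb) (∈-map⁺ g b∈)

mex-options-cong : ∀ {h h′ : ℕ → ℕ → ℕ} x y →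
  (∀ {a b} → (a , b) ∈ options x y → h a b ≡ h′ a b) →
  mex (map (uncurry' h) (options x y)) ≡ mex (map (uncurry' h′) (options x y))
mex-options-cong {h} {h′} x y agree =
  cong mex (map-cong-local {f = uncurry' h} {g = uncurry' h′}
    (tabulate λ { {a , b} a∈ → agree a∈ }))

GF-stable : ∀ f f′ x y → x + y < f → x + y < f′ → GF f x y ≡ GF f′ x y
GF-stable (suc f) (suc f′) x y (s≤s s≤f) (s≤s s≤f′) = mex-options-cong x y λ {a} {b} a∈ →
  GF-stable f f′ a b (<-≤-trans (options-decrease-sum x y a∈) s≤f)
                     (<-≤-trans (options-decrease-sum x y a∈) s≤f′)

GmF-stable : ∀ f f′ x y → x + y < f → x + y < f′ → GmF f x y ≡ GmF f′ x y
GmF-stable (suc f) (suc f′) zero    zero    _          _           = refl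
GmF-stable (suc f) (suc f′) zero    (suc y) (s≤s s≤f) (s≤s s≤f′) =
  mex-options-cong zero (suc y) λ {a} {b} a∈ →
    GmF-stable f f′ a b (<-≤-trans (options-decrease-sum zero (suc y) a∈) s≤f)
                        (<-≤-trans (options-decrease-sum zero (suc y) a∈) s≤f′)
GmF-stable (suc f) (suc f′) (suc x) y       (s≤s s≤f) (s≤s s≤f′) =
  mex-options-cong (suc x) y λ {a} {b} a∈ →
    GmF-stable f f′ a b (<-≤-trans (options-decrease-sum (suc x) y a∈) s≤f)
                        (<-≤-trans (options-decrease-sum (suc x) y a∈) s≤f′)

G-unfold : ∀ x y → G (x , y) ≡ mex (map G (options x y))
G-unfold x y = mex-options-cong x y λ {a} {b} a∈ →
  GF-stable (x + y) (suc (a + b)) a b (options-decrease-sum x y a∈) ≤-refl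

Gm-unfold : ∀ x y → ¬ isTerminal x y → Gm (x , y) ≡ mex (map Gm (options x y))
Gm-unfold zero    zero    nonterminal = ⊥-elim (nonterminal (refl , refl))
Gm-unfold zero    (suc y) _ = mex-options-cong zero (suc y) λ {a} {b} a∈ →
  GmF-stable (suc y) (suc (a + b)) a b (options-decrease-sum zero (suc y) a∈) ≤-refl
Gm-unfold (suc x) y       _ = mex-options-cong (suc x) y λ {a} {b} a∈ →
  GmF-stable (suc x + y) (suc (a + b)) a b (options-decrease-sum (suc x) y a∈) ≤-refl

movable-mono : ∀ {p} {P Q : Pos → Set} → (∀ {q} → P q → Q q) → Movable p P → Movable p Q
movable-mono P⇒Q (q , move , Pq) = q , move , P⇒Q Pq

data Exceptional₀₁ : Pos → Set where
  e00 : Exceptional₀₁ (0 , 0)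
  e12 : Exceptional₀₁ (1 , 2)
  e21 : Exceptional₀₁ (2 , 1)

data Exceptional₁₀ : Pos → Set where
  e01 : Exceptional₁₀ (0 , 1)
  e10 : Exceptional₁₀ (1 , 0)
  e22 : Exceptional₁₀ (2 , 2)

Exceptional : Pos → Set
Exceptional p = Exceptional₀₁ p ⊎ Exceptional₁₀ p

exceptional₀₁? : Decidable Exceptional₀₁
exceptional₀₁? q with q ≟ₚ (0 , 0) | q ≟ₚ (1 , 2) | q ≟ₚ (2 , 1)
... | yes refl | _        | _        = yes e00
... | no _     | yes refl | _        = yes e12
... | no _     | no _     | yes refl = yes e21
... | no q≢00  | no q≢12  | no q≢21  =
  no λ { e00 → q≢00 refl ; e12 → q≢12 refl ; e21 → q≢21 refl }

exceptional₁₀? : Decidable Exceptional₁₀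
exceptional₁₀? q with q ≟ₚ (0 , 1) | q ≟ₚ (1 , 0) | q ≟ₚ (2 , 2)
... | yes refl | _        | _        = yes e01
... | no _     | yes refl | _        = yes e10
... | no _     | no _     | yes refl = yes e22
... | no q≢01  | no q≢10  | no q≢22  =
  no λ { e01 → q≢01 refl ; e10 → q≢10 refl ; e22 → q≢22 refl }

exceptional? : Decidable Exceptional
exceptional? q = exceptional₀₁? q ⊎-dec exceptional₁₀? q

swap-exceptional₀₁ : ∀ {p} → Exceptional₀₁ p → Exceptional₀₁ (swap p)
swap-exceptional₀₁ e00 = e00
swap-exceptional₀₁ e12 = e21
swap-exceptional₀₁ e21 = e12

swap-exceptional₁₀ : ∀ {p} → Exceptional₁₀ p → Exceptional₁₀ (swap p)
swap-exceptional₁₀ e01 = e10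
swap-exceptional₁₀ e10 = e01
swap-exceptional₁₀ e22 = e22

swap-exceptional : ∀ {p} → Exceptional p → Exceptional (swap p)
swap-exceptional (inj₁ e) = inj₁ (swap-exceptional₀₁ e)
swap-exceptional (inj₂ e) = inj₂ (swap-exceptional₁₀ e)

exceptional₀₁⇒V₀₁ : ∀ {p} → Exceptional₀₁ p → V 0 1 p
exceptional₀₁⇒V₀₁ e00 = refl , refl
exceptional₀₁⇒V₀₁ e12 = refl , refl
exceptional₀₁⇒V₀₁ e21 = refl , refl

exceptional₁₀⇒V₁₀ : ∀ {p} → Exceptional₁₀ p → V 1 0 p
exceptional₁₀⇒V₁₀ e01 = refl , refl
exceptional₁₀⇒V₁₀ e10 = refl , refl
exceptional₁₀⇒V₁₀ e22 = refl , refl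

exceptional⇒V₀₁∪V₁₀ : ∀ {p} → Exceptional p → V01∪V10 p
exceptional⇒V₀₁∪V₁₀ (inj₁ e) = inj₁ (exceptional₀₁⇒V₀₁ e)
exceptional⇒V₀₁∪V₁₀ (inj₂ e) = inj₂ (exceptional₁₀⇒V₁₀ e)

exceptional-coordinates-≤2 : ∀ {a b} → Exceptional (a , b) → a ≤ 2 × b ≤ 2
exceptional-coordinates-≤2 (inj₁ e00) = z≤n , z≤n
exceptional-coordinates-≤2 (inj₁ e12) = s≤s z≤n , s≤s (s≤s z≤n)
exceptional-coordinates-≤2 (inj₁ e21) = s≤s (s≤s z≤n) , s≤s z≤n
exceptional-coordinates-≤2 (inj₂ e01) = z≤n , s≤s z≤n
exceptional-coordinates-≤2 (inj₂ e10) = s≤s z≤n , z≤n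
exceptional-coordinates-≤2 (inj₂ e22) = s≤s (s≤s z≤n) , s≤s (s≤s z≤n)

data LowRowOrDiagonal : Pos → Set where
  low-row     : ∀ {x y} → y ≤ 2 → LowRowOrDiagonal (x , y)
  diagonal    : ∀ {x} → LowRowOrDiagonal (x , x)
  subdiagonal : ∀ {y} → LowRowOrDiagonal (suc y , y)

NearExceptional : Pos → Set
NearExceptional p = LowRowOrDiagonal p ⊎ LowRowOrDiagonal (swap p)

move-to-exceptional⇒near : ∀ {p q} → Move p q → Exceptional q → NearExceptional p
move-to-exceptional⇒near (takeL _ _) e = inj₁ (low-row (proj₂ (exceptional-coordinates-≤2 e)))
move-to-exceptional⇒near (takeR _ _) e = inj₂ (low-row (proj₁ (exceptional-coordinates-≤2 e)))
move-to-exceptional⇒near (takeBoth {k = k} _ k≤x k≤y) e =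
  diagonal-move k (sym (m∸n+n≡m k≤x)) (sym (m∸n+n≡m k≤y)) e
  where
  diagonal-move : ∀ {x y a b} k → x ≡ a + k → y ≡ b + k →
    Exceptional (a , b) → NearExceptional (x , y)
  diagonal-move k refl refl (inj₁ e00) = inj₁ diagonal
  diagonal-move k refl refl (inj₁ e12) = inj₂ subdiagonal
  diagonal-move k refl refl (inj₁ e21) = inj₁ subdiagonal
  diagonal-move k refl refl (inj₂ e01) = inj₂ subdiagonal
  diagonal-move k refl refl (inj₂ e10) = inj₁ subdiagonal
  diagonal-move k refl refl (inj₂ e22) = inj₁ diagonal

MovesToBoth : Pos → Set
MovesToBoth p = Movable p Exceptional₀₁ × Movable p Exceptional₁₀

swap-movesToBoth : ∀ {p} → MovesToBoth p → MovesToBoth (swap p)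
swap-movesToBoth ((q₀₁ , m₀₁ , e₀₁) , (q₁₀ , m₁₀ , e₁₀)) =
  (swap q₀₁ , swap-move m₀₁ , swap-exceptional₀₁ e₀₁) ,
  (swap q₁₀ , swap-move m₁₀ , swap-exceptional₁₀ e₁₀)

low-row-or-diagonal⇒movesToBoth :
  ∀ {p} → LowRowOrDiagonal p → ¬ Exceptional p → MovesToBoth p
low-row-or-diagonal⇒movesToBoth (low-row {0} z≤n) ne = ⊥-elim (ne (inj₁ e00))
low-row-or-diagonal⇒movesToBoth (low-row {1} z≤n) ne = ⊥-elim (ne (inj₂ e10))
low-row-or-diagonal⇒movesToBoth (low-row {suc (suc x)} z≤n) _ =
  (_ , move-left 0 , e00) , (_ , move-left 1 , e10)
low-row-or-diagonal⇒movesToBoth (low-row {0} (s≤s z≤n)) ne = ⊥-elim (ne (inj₂ e01))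
low-row-or-diagonal⇒movesToBoth (low-row {1} (s≤s z≤n)) _ =
  (_ , move-diagonal 0 0 , e00) , (_ , move-left 0 , e01)
low-row-or-diagonal⇒movesToBoth (low-row {2} (s≤s z≤n)) ne = ⊥-elim (ne (inj₁ e21))
low-row-or-diagonal⇒movesToBoth (low-row {suc (suc (suc x))} (s≤s z≤n)) _ =
  (_ , move-left 2 , e21) , (_ , move-left 0 , e01)
low-row-or-diagonal⇒movesToBoth (low-row {0} (s≤s (s≤s z≤n))) _ =
  (_ , move-right 0 , e00) , (_ , move-right 1 , e01)
low-row-or-diagonal⇒movesToBoth (low-row {1} (s≤s (s≤s z≤n))) ne = ⊥-elim (ne (inj₁ e12))
low-row-or-diagonal⇒movesToBoth (low-row {2} (s≤s (s≤s z≤n))) ne = ⊥-elim (ne (inj₂ e22))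
low-row-or-diagonal⇒movesToBoth (low-row {suc (suc (suc x))} (s≤s (s≤s z≤n))) _ =
  (_ , move-left 1 , e12) , (_ , move-left 2 , e22)
low-row-or-diagonal⇒movesToBoth (diagonal {0}) ne = ⊥-elim (ne (inj₁ e00))
low-row-or-diagonal⇒movesToBoth (diagonal {1}) _ =
  (_ , move-diagonal 0 0 , e00) , (_ , move-left 0 , e01)
low-row-or-diagonal⇒movesToBoth (diagonal {2}) ne = ⊥-elim (ne (inj₂ e22))
low-row-or-diagonal⇒movesToBoth (diagonal {suc (suc (suc x))}) _ =
  (_ , move-diagonal 0 0 , e00) , (_ , move-diagonal 2 2 , e22)
low-row-or-diagonal⇒movesToBoth (subdiagonal {0}) ne = ⊥-elim (ne (inj₂ e10))
low-row-or-diagonal⇒movesToBoth (subdiagonal {1}) ne = ⊥-elim (ne (inj₁ e21))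
low-row-or-diagonal⇒movesToBoth (subdiagonal {2}) _ =
  (_ , move-left 1 , e12) , (_ , move-left 2 , e22)
low-row-or-diagonal⇒movesToBoth (subdiagonal {suc (suc (suc y))}) _ =
  (_ , move-diagonal 2 1 , e21) , (_ , move-diagonal 1 0 , e10)

move-to-exceptional⇒movesToBoth :
  ∀ {p q} → ¬ Exceptional p → Move p q → Exceptional q → MovesToBoth p
move-to-exceptional⇒movesToBoth ne move e with move-to-exceptional⇒near move e
... | inj₁ near = low-row-or-diagonal⇒movesToBoth near ne
... | inj₂ near = swap-movesToBoth
  (low-row-or-diagonal⇒movesToBoth near (λ e′ → ne (swap-exceptional e′)))

movesToBoth⇒exchanged-values : ∀ {p q} → MovesToBoth p → Exceptional q →
  ∃ λ q′ → Move p q′ × Gm q ≡ G q′ × G q ≡ Gm q′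
movesToBoth⇒exchanged-values (_ , (q′ , move , e′)) (inj₁ e)
  with exceptional₀₁⇒V₀₁ e | exceptional₁₀⇒V₁₀ e′
... | G≡0 , Gm≡1 | G′≡1 , Gm′≡0 = q′ , move , trans Gm≡1 (sym G′≡1) , trans G≡0 (sym Gm′≡0)
movesToBoth⇒exchanged-values ((q′ , move , e′) , _) (inj₂ e)
  with exceptional₁₀⇒V₁₀ e | exceptional₀₁⇒V₀₁ e′
... | G≡1 , Gm≡0 | G′≡0 , Gm′≡1 = q′ , move , trans Gm≡0 (sym G′≡0) , trans G≡1 (sym Gm′≡1)

Gm≡G-below : ∀ n x y → x + y < n → ¬ Exceptional (x , y) → Gm (x , y) ≡ G (x , y)
Gm≡G-below (suc n) x y (s≤s x+y≤n) ne = begin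
  Gm (x , y)        ≡⟨ Gm-unfold x y (λ { (refl , refl) → ne (inj₁ e00) }) ⟩
  mex (map Gm opts) ≡⟨ mex-cong (trans (length-map Gm opts) (sym (length-map G opts)))
                         Gm-values⊆G-values G-values⊆Gm-values ⟩
  mex (map G opts)  ≡⟨ G-unfold x y ⟨
  G (x , y)         ∎
  where
  open ≡-Reasoning
  opts : List Pos
  opts = options x y

  exchange : ∀ {q} → q ∈ opts → ∃ λ q′ → q′ ∈ opts × Gm q ≡ G q′ × G q ≡ Gm q′
  exchange {q} q∈ with exceptional? q
  ... | yes e = let q′ , move , eqs = movesToBoth⇒exchanged-values
                      (move-to-exceptional⇒movesToBoth ne (∈-options⇒Move q∈) e) e
                in q′ , Move⇒∈-options move , eqs
  exchange {a , b} q∈ | no ne′ =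
    let ih = Gm≡G-below n a b (<-≤-trans (options-decrease-sum x y q∈) x+y≤n) ne′
    in (a , b) , q∈ , ih , sym ih

  Gm-values⊆G-values : map Gm opts ⊆ map G opts
  Gm-values⊆G-values = map-⊆-map λ q∈ → let q′ , q′∈ , Gm≡G′ , _ = exchange q∈ in q′ , q′∈ , Gm≡G′

  G-values⊆Gm-values : map G opts ⊆ map Gm opts
  G-values⊆Gm-values = map-⊆-map λ q∈ → let q′ , q′∈ , _ , G≡Gm′ = exchange q∈ in q′ , q′∈ , G≡Gm′

Gm≡G : ∀ p → ¬ Exceptional p → Gm p ≡ G p
Gm≡G (x , y) = Gm≡G-below (suc (x + y)) x y ≤-refl

V₀₁∪V₁₀⇒exceptional : ∀ {p} → V01∪V10 p → Exceptional p
V₀₁∪V₁₀⇒exceptional {p} v with exceptional? p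
... | yes e = e
V₀₁∪V₁₀⇒exceptional {p} (inj₁ (G≡0 , Gm≡1)) | no ne =
  ⊥-elim (1+n≢0 (trans (sym Gm≡1) (trans (Gm≡G p ne) G≡0)))
V₀₁∪V₁₀⇒exceptional {p} (inj₂ (G≡1 , Gm≡0)) | no ne =
  ⊥-elim (0≢1+n (trans (sym Gm≡0) (trans (Gm≡G p ne) G≡1)))

proposition6p9 : Miserable
proposition6p9 p with exceptional? p | movable? exceptional? p
... | yes e | _ = inj₁ (exceptional⇒V₀₁∪V₁₀ e)
... | no ne | yes (q , move , e) =
  let to₀₁ , to₁₀ = move-to-exceptional⇒movesToBoth ne move e
  in inj₂ (inj₂ (movable-mono exceptional₀₁⇒V₀₁ to₀₁ , movable-mono exceptional₁₀⇒V₁₀ to₁₀))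
... | no _  | no stuck =
  inj₂ (inj₁ λ to-V → stuck (movable-mono V₀₁∪V₁₀⇒exceptional to-V))
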